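{- Let $\alpha\in(0,1)$ be irrational. (i) If $\{r_i\}_{i\in\mathbb{N}}$ is a complete left best approximation of $\alpha$, then $r_{i+1}-r_i>r_{i+2}-r_{i+1}$ for all $i\in\mathbb{N}$. (ii) If $\{r_i\}_{i\in\mathbb{N}}$ is a complete right best approximation of $\alpha$, then $r_i-r_{i+1}>r_{i+1}-r_{i+2}$ for all $i\in\mathbb{N}$.
   Context: A fraction $a/b$ with $a,b$ coprime naturals is a left best approximant of $\alpha$ if for all naturals $c,d$ with $d\le b$ we have $c/d\le a/b<\alpha$ or $\alpha<c/d$; it is a right best approximant if for all such $c,d$ we have $\alpha<a/b\le c/d$ or $c/d<\alpha$. A left best approximation of $\alpha$ is a sequence of rationals $0=r_0<r_1<r_2<\cdots$ each of which is a left best approximant of $\alpha$; a right best approximation is a sequence $1=r_0>r_1>r_2>\cdots$ of right best approximants. Such a sequence is complete if every left (resp. right) best approximant of $\alpha$ occurs in it. -}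

module Defs where

open import Data.Nat using (ℕ; suc; _≤_)
open import Data.Integer using (+_)
open import Data.Rational using (ℚ; _/_; _<_; 0ℚ; 1ℚ; ↧ₙ_)
import Data.Rational as Q
open import Data.Product using (Σ; _×_)
open import Data.Sum using (_⊎_)
open import Data.Empty using (⊥)
open import Relation.Binary.PropositionalEquality using (_≡_)

-- An irrational real number α ∈ (0,1), given by its (Dedekind) cut:
-- Lt q means q < α, Gt q means α < q.
record IrrationalIn01 : Set₁ where
  field
    Lt Gt      : ℚ → Set
    located    : ∀ q → Lt q ⊎ Gt q
    disjoint   : ∀ q → Lt q → Gt q → ⊥
    Lt-down    : ∀ p q → p < q → Lt q → Lt p
    Gt-up      : ∀ p q → p < q → Gt p → Gt q
    Lt-open    : ∀ q → Lt q → Σ ℚ (λ q' → q < q' × Lt q')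
    Gt-open    : ∀ q → Gt q → Σ ℚ (λ q' → q' < q × Gt q')
    Lt-zero    : Lt 0ℚ
    Gt-one     : Gt 1ℚ

open IrrationalIn01 public

frac : ℕ → ℕ → ℚ
frac c k = + c / suc k

-- a/b (a,b coprime naturals, i.e. a normalised non-negative rational q,
-- b = ↧ₙ q) is a left best approximant of α: for all naturals c,d with
-- d ≤ b:  c/d ≤ a/b < α  or  α < c/d.
LeftBestApproximant : IrrationalIn01 → ℚ → Set
LeftBestApproximant α q =
  (0ℚ Q.≤ q) ×
  (∀ (c k : ℕ) → suc k ≤ ↧ₙ q →
     ((frac c k Q.≤ q) × Lt α q) ⊎ Gt α (frac c k))

RightBestApproximant : IrrationalIn01 → ℚ → Set
RightBestApproximant α q =
  (0ℚ Q.≤ q) ×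
  (∀ (c k : ℕ) → suc k ≤ ↧ₙ q →
     (Gt α q × (q Q.≤ frac c k)) ⊎ Lt α (frac c k))

LeftBestApproximation : IrrationalIn01 → (ℕ → ℚ) → Set
LeftBestApproximation α r =
  (r 0 ≡ 0ℚ) × (∀ i → r i < r (suc i)) × (∀ i → LeftBestApproximant α (r i))

RightBestApproximation : IrrationalIn01 → (ℕ → ℚ) → Set
RightBestApproximation α r =
  (r 0 ≡ 1ℚ) × (∀ i → r (suc i) < r i) × (∀ i → RightBestApproximant α (r i))

CompleteLeft : IrrationalIn01 → (ℕ → ℚ) → Set
CompleteLeft α r = LeftBestApproximation α r ×
  (∀ q → LeftBestApproximant α q → Σ ℕ (λ i → r i ≡ q))

CompleteRight : IrrationalIn01 → (ℕ → ℚ) → Set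
CompleteRight α r = RightBestApproximation α r ×
  (∀ q → RightBestApproximant α q → Σ ℕ (λ i → r i ≡ q))

-- Call a/b < c/d Farey neighbours when bc − ad = 1. Then c/d − a/b = 1/(bd), and every
-- fraction strictly between them has denominator at least b + d; so if a/b < α < c/d are
-- neighbours, a/b is a left and c/d a right best approximant.
-- In the left case, r i comes with a neighbour above α. The iterated mediants of that
-- neighbour with r i decrease towards r i, each adjacent to r i and to its predecessor, and
-- they drop below α before their denominator exceeds that of r (i+1). The first one below α
-- is a left best approximant, and completeness together with the Farey bound identifies it
-- with r (i+1). Hence consecutive terms are neighbours with increasing denominators b i, and
-- the gaps 1/(b i · b (i+1)) decrease. The right case is the mirror image.
module Submission where

open import Defs
open import Data.Nat using (ℕ; suc; zero; _≤_; _≤′_; ≤′-refl; ≤′-step; s≤s; z≤n; pred)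
  renaming (_+_ to _+ₙ_; _*_ to _*ₙ_; _<_ to _<ₙ_)
import Data.Nat.Properties as ℕ
open import Data.Nat.Divisibility using (∣⇒≤; divides)
open import Data.Nat.GCD using (gcd)
open import Data.Nat.GeneralisedArithmetic using (fold)
open import Data.Nat.Tactic.RingSolver as ℕ-Solver using ()
open import Data.Integer using (+_; +<+)
import Data.Integer as ℤ
import Data.Integer.Properties as ℤ
open import Data.Integer.Tactic.RingSolver as ℤ-Solver using ()
open import Data.Rational using (ℚ; mkℚ; _<_; _-_; 0ℚ; 1ℚ; ↥_; ↧ₙ_; toℚᵘ; *≤*)
import Data.Rational as ℚ
import Data.Rational.Properties as ℚ
import Data.Rational.Unnormalised as ℚᵘ
import Data.Rational.Unnormalised.Properties as ℚᵘ
open import Data.List using (_∷_; [])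
open import Data.Product using (∃-syntax; _×_; _,_; proj₁; proj₂)
open import Data.Sum using (_⊎_; inj₁; inj₂; swap)
open import Data.Empty using (⊥-elim)
open import Relation.Nullary using (¬_; yes; no; contradiction)
open import Relation.Binary.Definitions using (Reflexive; Transitive; tri<; tri≈; tri>)
open import Relation.Binary.PropositionalEquality

stepwise-mono : ∀ {a ℓ} {A : Set a} (_≼_ : A → A → Set ℓ) → Reflexive _≼_ → Transitive _≼_ →
                (f : ℕ → A) → (∀ i → f i ≼ f (suc i)) → ∀ {i j} → i ≤ j → f i ≼ f j
stepwise-mono _≼_ refl′ trans′ f step i≤j = go (ℕ.≤⇒≤′ i≤j)
  where
  go : ∀ {i j} → i ≤′ j → f i ≼ f j
  go ≤′-refl = refl′
  go (≤′-step i≤′j) = trans′ (go i≤′j) (step _)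

crossing : ∀ {p q} {P : ℕ → Set p} {Q : ℕ → Set q} → (∀ t → P t ⊎ Q t) → ¬ P 0 →
           ∀ T → P T → ∃[ t ] Q t × P (suc t)
crossing located ¬P₀ zero P₀ = contradiction P₀ ¬P₀
crossing located ¬P₀ (suc T) P[1+T] with located T
... | inj₁ P[T] = crossing located ¬P₀ T P[T]
... | inj₂ Q[T] = T , Q[T] , P[1+T]

record Fraction : Set where
  constructor _/1+_
  field
    num den-1 : ℕ

  den : ℕ
  den = suc den-1

open Fraction

data _≺_ (x y : Fraction) : Set where
  *<* : num x *ₙ den y <ₙ num y *ₙ den x → x ≺ y

_⊕_ : Fraction → Fraction → Fraction
x ⊕ y = (num x +ₙ num y) /1+ (den-1 x +ₙ den y)

data Adjacent (x y : Fraction) : Set where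
  adjacent : den x *ₙ num y ≡ num x *ₙ den y +ₙ 1 → Adjacent x y

toFraction : ℚ → Fraction
toFraction q = ℤ.∣ ↥ q ∣ /1+ ℚ.denominator-1 q

-- Opaque: unfolding the gcd normalisation inside frac makes type checking explode.
opaque
  ⟦_⟧ : Fraction → ℚ
  ⟦ x ⟧ = frac (num x) (den-1 x)

  ⟦⟧≡frac : ∀ x → ⟦ x ⟧ ≡ frac (num x) (den-1 x)
  ⟦⟧≡frac x = refl

  toℚᵘ-⟦⟧ : ∀ x → toℚᵘ ⟦ x ⟧ ℚᵘ.≃ ℚᵘ.mkℚᵘ (+ num x) (den-1 x)
  toℚᵘ-⟦⟧ (n /1+ k) = ℚ.toℚᵘ-fromℚᵘ (ℚᵘ.mkℚᵘ (+ n) k)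

  ⟦⟧-nonNeg : ∀ x → 0ℚ ℚ.≤ ⟦ x ⟧
  ⟦⟧-nonNeg (n /1+ k) = ℚ.nonNegative⁻¹ (frac n k) {{ℚ.normalize-nonNeg n (suc k)}}

  ↧ₙ⟦⟧≤den : ∀ x → ↧ₙ ⟦ x ⟧ ≤ den x
  ↧ₙ⟦⟧≤den (n /1+ k) = ∣⇒≤ (divides (gcd n (suc k)) (sym (trans (ℕ.*-comm (gcd n (suc k)) _) ↧ₙ*gcd≡)))
    where
    ↧ₙ*gcd≡ : ↧ₙ frac n k *ₙ gcd n (suc k) ≡ suc k
    ↧ₙ*gcd≡ = ℤ.+-injective (trans (ℤ.pos-* (↧ₙ frac n k) (gcd n (suc k))) (ℚ.↧-/ (+ n) (suc k)))

  ⟦toFraction⟧ : ∀ q → 0ℚ ℚ.≤ q → ⟦ toFraction q ⟧ ≡ q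
  ⟦toFraction⟧ q@(mkℚ (+ n) k _) _ = ℚ.fromℚᵘ-toℚᵘ q
  ⟦toFraction⟧ (mkℚ ℤ.-[1+ n ] _ _) (*≤* ())

≺⇒< : ∀ {x y} → x ≺ y → ⟦ x ⟧ < ⟦ y ⟧
≺⇒< {x} {y} (*<* x≺y) = ℚ.toℚᵘ-cancel-<
  (ℚᵘ.<-respˡ-≃ (ℚᵘ.≃-sym (toℚᵘ-⟦⟧ x)) (ℚᵘ.<-respʳ-≃ (ℚᵘ.≃-sym (toℚᵘ-⟦⟧ y))
    (ℚᵘ.*<* (subst₂ ℤ._<_ (ℤ.pos-* (num x) (den y)) (ℤ.pos-* (num y) (den x)) (+<+ x≺y)))))

<⇒≺ : ∀ {x y} → ⟦ x ⟧ < ⟦ y ⟧ → x ≺ y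
<⇒≺ {x} {y} x<y
  with ℚᵘ.*<* lt ← ℚᵘ.<-respˡ-≃ (toℚᵘ-⟦⟧ x) (ℚᵘ.<-respʳ-≃ (toℚᵘ-⟦⟧ y) (ℚ.toℚᵘ-mono-< x<y))
  with +<+ x≺y ← subst₂ ℤ._<_ (sym (ℤ.pos-* (num x) (den y))) (sym (ℤ.pos-* (num y) (den x))) lt
  = *<* x≺y

den<den-⊕ˡ : ∀ x y → den x <ₙ den (x ⊕ y)
den<den-⊕ˡ x y = s≤s (ℕ.m<m+n (den-1 x) ℕ.0<1+n)

den<den-⊕ʳ : ∀ x y → den y <ₙ den (x ⊕ y)
den<den-⊕ʳ x y = s≤s (ℕ.m≤n+m (den y) (den-1 x))

adjacent⇒≺ : ∀ {x y} → Adjacent x y → x ≺ y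
adjacent⇒≺ {x} {y} (adjacent adj) =
  *<* (subst (num x *ₙ den y <ₙ_) (trans (sym adj) (ℕ.*-comm (den x) (num y))) (ℕ.m<m+n _ ℕ.0<1+n))

adjacent-⊕ˡ : ∀ {x y} → Adjacent x y → Adjacent x (x ⊕ y)
adjacent-⊕ˡ {nx /1+ kx} {ny /1+ ky} (adjacent adj) = adjacent (begin
  suc kx *ₙ (nx +ₙ ny)                 ≡⟨ ℕ-Solver.solve (kx ∷ nx ∷ ny ∷ []) ⟩
  nx *ₙ suc kx +ₙ suc kx *ₙ ny         ≡⟨ cong (nx *ₙ suc kx +ₙ_) adj ⟩
  nx *ₙ suc kx +ₙ (nx *ₙ suc ky +ₙ 1)  ≡⟨ ℕ-Solver.solve (nx ∷ kx ∷ ky ∷ []) ⟩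
  nx *ₙ suc (kx +ₙ suc ky) +ₙ 1        ∎)
  where open ≡-Reasoning

adjacent-⊕ʳ : ∀ {x y} → Adjacent x y → Adjacent (x ⊕ y) y
adjacent-⊕ʳ {nx /1+ kx} {ny /1+ ky} (adjacent adj) = adjacent (begin
  suc (kx +ₙ suc ky) *ₙ ny             ≡⟨ ℕ-Solver.solve (kx ∷ ky ∷ ny ∷ []) ⟩
  suc kx *ₙ ny +ₙ ny *ₙ suc ky         ≡⟨ cong (_+ₙ ny *ₙ suc ky) adj ⟩
  nx *ₙ suc ky +ₙ 1 +ₙ ny *ₙ suc ky    ≡⟨ ℕ-Solver.solve (nx ∷ ky ∷ ny ∷ []) ⟩
  (nx +ₙ ny) *ₙ suc ky +ₙ 1            ∎)
  where open ≡-Reasoning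

adjacent-between-den : ∀ {x y q} → Adjacent x y → x ≺ q → q ≺ y → den x +ₙ den y ≤ den q
adjacent-between-den {x} {y} {q} (adjacent adj) (*<* x≺q) (*<* q≺y)
  with o , x-gap ← ℕ.m≤n⇒∃[o]m+o≡n x≺q
     | o′ , y-gap ← ℕ.m≤n⇒∃[o]m+o≡n q≺y
  = subst (den x +ₙ den y ≤_)
      (sym (decompose (num x) (den x) (num y) (den y) (num q) (den q) o o′ adj x-gap y-gap))
      (ℕ.+-mono-≤ (ℕ.m≤m*n (den x) (suc o′)) (ℕ.m≤m*n (den y) (suc o)))
  where
  -- Multiply den q by den x · num y − num x · den y = 1 and regroup, avoiding subtraction.
  decompose : ∀ nx dx ny dy nq dq o o′ → dx *ₙ ny ≡ nx *ₙ dy +ₙ 1 →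
              suc (nx *ₙ dq) +ₙ o ≡ nq *ₙ dx → suc (nq *ₙ dy) +ₙ o′ ≡ ny *ₙ dq →
              dq ≡ dx *ₙ suc o′ +ₙ dy *ₙ suc o
  decompose nx dx ny dy nq dq o o′ adj x-gap y-gap = ℕ.+-cancelˡ-≡ (nx *ₙ dy *ₙ dq) _ _ (begin
    nx *ₙ dy *ₙ dq +ₙ dq                        ≡⟨ ℕ-Solver.solve (nx ∷ dy ∷ dq ∷ []) ⟩
    dq *ₙ (nx *ₙ dy +ₙ 1)                       ≡⟨ cong (dq *ₙ_) adj ⟨
    dq *ₙ (dx *ₙ ny)                            ≡⟨ ℕ-Solver.solve (dq ∷ dx ∷ ny ∷ []) ⟩
    dx *ₙ (ny *ₙ dq)                            ≡⟨ cong (dx *ₙ_) y-gap ⟨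
    dx *ₙ (suc (nq *ₙ dy) +ₙ o′)                ≡⟨ ℕ-Solver.solve (dx ∷ nq ∷ dy ∷ o′ ∷ []) ⟩
    dy *ₙ (nq *ₙ dx) +ₙ dx *ₙ suc o′            ≡⟨ cong (λ m → dy *ₙ m +ₙ dx *ₙ suc o′) x-gap ⟨
    dy *ₙ (suc (nx *ₙ dq) +ₙ o) +ₙ dx *ₙ suc o′ ≡⟨ ℕ-Solver.solve (dy ∷ nx ∷ dq ∷ o ∷ dx ∷ o′ ∷ []) ⟩
    nx *ₙ dy *ₙ dq +ₙ (dx *ₙ suc o′ +ₙ dy *ₙ suc o) ∎)
    where open ≡-Reasoning

adjacent-numerator : ∀ {x y} → Adjacent x y →
                     + num y ℤ.* + den x ℤ.+ ℤ.- (+ num x) ℤ.* + den y ≡ + 1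
adjacent-numerator {x} {y} (adjacent adj) = begin
  + num y ℤ.* + den x ℤ.+ ℤ.- (+ num x) ℤ.* + den y         ≡⟨ cong (ℤ._+ ℤ.- (+ num x) ℤ.* + den y) cross ⟩
  + num x ℤ.* + den y ℤ.+ + 1 ℤ.+ ℤ.- (+ num x) ℤ.* + den y ≡⟨ cancel (+ num x) (+ den y) ⟩
  + 1                                                       ∎
  where
  open ≡-Reasoning
  cancel : ∀ a b → a ℤ.* b ℤ.+ + 1 ℤ.+ ℤ.- a ℤ.* b ≡ + 1
  cancel = ℤ-Solver.solve-∀
  cross : + num y ℤ.* + den x ≡ + num x ℤ.* + den y ℤ.+ + 1
  cross = begin
    + num y ℤ.* + den x          ≡⟨ ℤ.pos-* (num y) (den x) ⟨
    + (num y *ₙ den x)           ≡⟨ cong +_ (trans (ℕ.*-comm (num y) (den x)) adj) ⟩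
    + (num x *ₙ den y +ₙ 1)      ≡⟨ ℤ.pos-+ (num x *ₙ den y) 1 ⟩
    + (num x *ₙ den y) ℤ.+ + 1   ≡⟨ cong (ℤ._+ + 1) (ℤ.pos-* (num x) (den y)) ⟩
    + num x ℤ.* + den y ℤ.+ + 1  ∎

adjacent-gap : ∀ {x y} → Adjacent x y → ⟦ y ⟧ - ⟦ x ⟧ ≡ ⟦ 1 /1+ pred (den x *ₙ den y) ⟧
adjacent-gap {x} {y} adj = ℚ.toℚᵘ-injective (begin
  toℚᵘ (⟦ y ⟧ - ⟦ x ⟧)                   ≈⟨ ℚ.toℚᵘ-homo-+ ⟦ y ⟧ (ℚ.- ⟦ x ⟧) ⟩
  toℚᵘ ⟦ y ⟧ ℚᵘ.+ toℚᵘ (ℚ.- ⟦ x ⟧)        ≈⟨ ℚᵘ.+-congʳ (toℚᵘ ⟦ y ⟧) (ℚ.toℚᵘ-homo‿- ⟦ x ⟧) ⟩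
  toℚᵘ ⟦ y ⟧ ℚᵘ.- toℚᵘ ⟦ x ⟧              ≈⟨ ℚᵘ.+-cong (toℚᵘ-⟦⟧ y) (ℚᵘ.-‿cong (toℚᵘ-⟦⟧ x)) ⟩
  ℚᵘ.mkℚᵘ (+ num y) (den-1 y) ℚᵘ.- ℚᵘ.mkℚᵘ (+ num x) (den-1 x)
    ≈⟨ ℚᵘ.*≡* (cong₂ ℤ._*_ (adjacent-numerator adj) (cong +_ (ℕ.*-comm (den x) (den y)))) ⟩
  ℚᵘ.mkℚᵘ (+ 1) (pred (den x *ₙ den y))  ≈⟨ toℚᵘ-⟦⟧ (1 /1+ pred (den x *ₙ den y)) ⟨
  toℚᵘ ⟦ 1 /1+ pred (den x *ₙ den y) ⟧    ∎)
  where open ℚᵘ.≃-Reasoning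

adjacent-gap-< : ∀ {a b c d} → Adjacent a b → Adjacent c d → den a *ₙ den b <ₙ den c *ₙ den d →
                 ⟦ d ⟧ - ⟦ c ⟧ < ⟦ b ⟧ - ⟦ a ⟧
adjacent-gap-< {a} {b} {c} {d} ab cd lt = subst₂ _<_ (sym (adjacent-gap cd)) (sym (adjacent-gap ab))
  (≺⇒< {1 /1+ pred (den c *ₙ den d)} {1 /1+ pred (den a *ₙ den b)}
    (*<* (subst₂ _<ₙ_ (sym (ℕ.*-identityˡ _)) (sym (ℕ.*-identityˡ _)) lt)))

module _ (α : IrrationalIn01) where

  below<above : ∀ {p q} → Lt α p → Gt α q → p < q
  below<above {p} {q} p-below q-above with ℚ.<-cmp p q
  ... | tri< p<q _ _ = p<q
  ... | tri≈ _ refl _ = ⊥-elim (disjoint α p p-below q-above)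
  ... | tri> _ _ q<p = ⊥-elim (disjoint α p p-below (Gt-up α q p q<p q-above))

  leftBest-at : ∀ {p} → LeftBestApproximant α p →
                ∀ q → den q ≤ ↧ₙ p → (⟦ q ⟧ ℚ.≤ p × Lt α p) ⊎ Gt α ⟦ q ⟧
  leftBest-at {p} (_ , best) q small =
    subst (λ q′ → (q′ ℚ.≤ p × Lt α p) ⊎ Gt α q′) (sym (⟦⟧≡frac q)) (best (num q) (den-1 q) small)

  leftBest-intro : ∀ {p} → 0ℚ ℚ.≤ p →
                   (∀ q → den q ≤ ↧ₙ p → (⟦ q ⟧ ℚ.≤ p × Lt α p) ⊎ Gt α ⟦ q ⟧) →
                   LeftBestApproximant α p
  leftBest-intro {p} nonNeg best = nonNeg , λ c k small →
    subst (λ q′ → (q′ ℚ.≤ p × Lt α p) ⊎ Gt α q′) (⟦⟧≡frac (c /1+ k)) (best (c /1+ k) small)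

  rightBest-at : ∀ {p} → RightBestApproximant α p →
                 ∀ q → den q ≤ ↧ₙ p → (Gt α p × p ℚ.≤ ⟦ q ⟧) ⊎ Lt α ⟦ q ⟧
  rightBest-at {p} (_ , best) q small =
    subst (λ q′ → (Gt α p × p ℚ.≤ q′) ⊎ Lt α q′) (sym (⟦⟧≡frac q)) (best (num q) (den-1 q) small)

  rightBest-intro : ∀ {p} → 0ℚ ℚ.≤ p →
                    (∀ q → den q ≤ ↧ₙ p → (Gt α p × p ℚ.≤ ⟦ q ⟧) ⊎ Lt α ⟦ q ⟧) →
                    RightBestApproximant α p
  rightBest-intro {p} nonNeg best = nonNeg , λ c k small →
    subst (λ q′ → (Gt α p × p ℚ.≤ q′) ⊎ Lt α q′) (⟦⟧≡frac (c /1+ k)) (best (c /1+ k) small)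

  leftBest⇒below : ∀ {q} → LeftBestApproximant α q → Lt α q
  leftBest⇒below (_ , best) with best 0 0 (s≤s z≤n)
  ... | inj₁ (_ , q-below) = q-below
  ... | inj₂ 0-above = ⊥-elim (disjoint α 0ℚ (Lt-zero α) 0-above)

  rightBest⇒above : ∀ {q} → RightBestApproximant α q → Gt α q
  rightBest⇒above (_ , best) with best 1 0 (s≤s z≤n)
  ... | inj₁ (q-above , _) = q-above
  ... | inj₂ 1-below = ⊥-elim (disjoint α 1ℚ 1-below (Gt-one α))

  adjacent⇒leftBest : ∀ {x y} → Adjacent x y → Lt α ⟦ x ⟧ → Gt α ⟦ y ⟧ → LeftBestApproximant α ⟦ x ⟧
  adjacent⇒leftBest {x} {y} adj x-below y-above = leftBest-intro (⟦⟧-nonNeg x) best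
    where
    best : ∀ q → den q ≤ ↧ₙ ⟦ x ⟧ → (⟦ q ⟧ ℚ.≤ ⟦ x ⟧ × Lt α ⟦ x ⟧) ⊎ Gt α ⟦ q ⟧
    best q small with located α ⟦ q ⟧
    ... | inj₂ q-above = inj₂ q-above
    ... | inj₁ q-below = inj₁ (ℚ.≮⇒≥ not-between , x-below)
      where
      not-between : ¬ ⟦ x ⟧ < ⟦ q ⟧
      not-between x<q = ℕ.<⇒≱ (ℕ.m<m+n (den x) ℕ.0<1+n)
        (ℕ.≤-trans (adjacent-between-den adj (<⇒≺ {x} {q} x<q) (<⇒≺ {q} {y} (below<above q-below y-above)))
                   (ℕ.≤-trans small (↧ₙ⟦⟧≤den x)))

  adjacent⇒rightBest : ∀ {x y} → Adjacent x y → Lt α ⟦ x ⟧ → Gt α ⟦ y ⟧ → RightBestApproximant α ⟦ y ⟧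
  adjacent⇒rightBest {x} {y} adj x-below y-above = rightBest-intro (⟦⟧-nonNeg y) best
    where
    best : ∀ q → den q ≤ ↧ₙ ⟦ y ⟧ → (Gt α ⟦ y ⟧ × ⟦ y ⟧ ℚ.≤ ⟦ q ⟧) ⊎ Lt α ⟦ q ⟧
    best q small with located α ⟦ q ⟧
    ... | inj₁ q-below = inj₂ q-below
    ... | inj₂ q-above = inj₁ (y-above , ℚ.≮⇒≥ not-between)
      where
      not-between : ¬ ⟦ q ⟧ < ⟦ y ⟧
      not-between q<y = ℕ.<⇒≱ (ℕ.m<n+m (den y) ℕ.0<1+n)
        (ℕ.≤-trans (adjacent-between-den adj (<⇒≺ {x} {q} (below<above x-below q-above)) (<⇒≺ {q} {y} q<y))
                   (ℕ.≤-trans small (↧ₙ⟦⟧≤den y)))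

module CompleteLeftSequence (α : IrrationalIn01) (r : ℕ → ℚ) (complete : CompleteLeft α r) where

  increasing : ∀ i → r i < r (suc i)
  increasing = proj₁ (proj₂ (proj₁ complete))

  best : ∀ i → LeftBestApproximant α (r i)
  best = proj₂ (proj₂ (proj₁ complete))

  monotone : ∀ {i j} → i ≤ j → r i ℚ.≤ r j
  monotone = stepwise-mono ℚ._≤_ ℚ.≤-refl ℚ.≤-trans r (λ i → ℚ.<⇒≤ (increasing i))

  successor-≤ : ∀ {i q} → LeftBestApproximant α q → r i < q → r (suc i) ℚ.≤ q
  successor-≤ {i} q-best ri<q with proj₂ complete _ q-best
  ... | j , refl with suc i ℕ.≤? j
  ...   | yes i<j = monotone i<j
  ...   | no i≮j = ⊥-elim (ℚ.<-irrefl refl (ℚ.<-≤-trans ri<q (monotone (ℕ.≤-pred (ℕ.≰⇒> i≮j)))))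

  record Stage (i : ℕ) : Set where
    field
      current neighbour : Fraction
      r≡current : r i ≡ ⟦ current ⟧
      neighbour-adjacent : Adjacent current neighbour
      neighbour-above : Gt α ⟦ neighbour ⟧

  module Step {i : ℕ} (s : Stage i) where
    open Stage s

    approach : ℕ → Fraction
    approach = fold neighbour (current ⊕_)

    adjacent-approach : ∀ t → Adjacent current (approach t)
    adjacent-approach zero = neighbour-adjacent
    adjacent-approach (suc t) = adjacent-⊕ˡ (adjacent-approach t)

    t<den-approach : ∀ t → t <ₙ den (approach t)
    t<den-approach zero = ℕ.0<1+n
    t<den-approach (suc t) = ℕ.≤-<-trans (t<den-approach t) (den<den-⊕ʳ current (approach t))

    y : Fraction
    y = toFraction (r (suc i))

    ⟦y⟧≡ : ⟦ y ⟧ ≡ r (suc i)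
    ⟦y⟧≡ = ⟦toFraction⟧ (r (suc i)) (proj₁ (best (suc i)))

    current≺y : current ≺ y
    current≺y = <⇒≺ {current} {y} (subst₂ _<_ r≡current (sym ⟦y⟧≡) (increasing i))

    approach-eventually-below : Lt α ⟦ approach (den y) ⟧
    approach-eventually-below with located α ⟦ approach (den y) ⟧
    ... | inj₁ below = below
    ... | inj₂ above = ⊥-elim (ℕ.<⇒≱ (t<den-approach (den y))
            (ℕ.≤-trans (ℕ.m≤n+m _ (den current))
              (adjacent-between-den (adjacent-approach (den y)) current≺y y≺approach)))
      where
      y-below : Lt α ⟦ y ⟧
      y-below = subst (Lt α) (sym ⟦y⟧≡) (leftBest⇒below α (best (suc i)))
      y≺approach : y ≺ approach (den y)
      y≺approach = <⇒≺ {y} {approach (den y)} (below<above α y-below above)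

    crossover : ∃[ t ] Gt α ⟦ approach t ⟧ × Lt α ⟦ approach (suc t) ⟧
    crossover = crossing (λ t → located α ⟦ approach t ⟧)
                  (λ below → disjoint α _ below neighbour-above) (den y) approach-eventually-below

    t : ℕ
    t = proj₁ crossover

    next : Fraction
    next = approach (suc t)

    next-below : Lt α ⟦ next ⟧
    next-below = proj₂ (proj₂ crossover)

    adjacent-next : Adjacent current next
    adjacent-next = adjacent-approach (suc t)

    den-current<den-next : den current <ₙ den next
    den-current<den-next = den<den-⊕ˡ current (approach t)

    next-best : LeftBestApproximant α ⟦ next ⟧
    next-best = adjacent⇒leftBest α (adjacent-⊕ʳ (adjacent-approach t)) next-below (proj₁ (proj₂ crossover))

    den-next≤ : r (suc i) < ⟦ next ⟧ → den next ≤ ↧ₙ r (suc i)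
    den-next≤ ri+1<next = ℕ.≤-trans (ℕ.m≤n+m (den next) (den current))
      (adjacent-between-den adjacent-next current≺y
        (<⇒≺ {y} {next} (subst (_< ⟦ next ⟧) (sym ⟦y⟧≡) ri+1<next)))

    r-suc≮next : ¬ r (suc i) < ⟦ next ⟧
    r-suc≮next ri+1<next with leftBest-at α (best (suc i)) next (den-next≤ ri+1<next)
    ... | inj₁ (next≤ri+1 , _) = ℚ.<-irrefl refl (ℚ.<-≤-trans ri+1<next next≤ri+1)
    ... | inj₂ next-above = disjoint α _ next-below next-above

    r-suc≡next : r (suc i) ≡ ⟦ next ⟧
    r-suc≡next = ℚ.≤-antisym (successor-≤ next-best current<next) (ℚ.≮⇒≥ r-suc≮next)
      where
      current<next : r i < ⟦ next ⟧
      current<next = subst (_< ⟦ next ⟧) (sym r≡current) (≺⇒< {current} {next} (adjacent⇒≺ adjacent-next))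

    next-stage : Stage (suc i)
    next-stage = record
      { current = next
      ; neighbour = approach t
      ; r≡current = r-suc≡next
      ; neighbour-adjacent = adjacent-⊕ʳ (adjacent-approach t)
      ; neighbour-above = proj₁ (proj₂ crossover)
      }

  stage : ∀ i → Stage i
  stage zero = record
    { current = 0 /1+ 0
    ; neighbour = 1 /1+ 0
    ; r≡current = trans (proj₁ (proj₁ complete)) (sym (⟦⟧≡frac (0 /1+ 0)))
    ; neighbour-adjacent = adjacent refl
    ; neighbour-above = subst (Gt α) (sym (⟦⟧≡frac (1 /1+ 0))) (Gt-one α)
    }
  stage (suc i) = Step.next-stage (stage i)

  gaps-decrease : ∀ i → r (suc (suc i)) - r (suc i) < r (suc i) - r i
  gaps-decrease i =
    subst₂ _<_ (sym (cong₂ _-_ (r≡current s₂) (r≡current s₁)))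
               (sym (cong₂ _-_ (r≡current s₁) (r≡current s₀)))
      (adjacent-gap-< (Step.adjacent-next s₀) (Step.adjacent-next s₁) dens<)
    where
    open Stage
    s₀ : Stage i
    s₀ = stage i
    s₁ : Stage (suc i)
    s₁ = stage (suc i)
    s₂ : Stage (suc (suc i))
    s₂ = stage (suc (suc i))
    dens< : den (current s₀) *ₙ den (current s₁) <ₙ den (current s₁) *ₙ den (current s₂)
    dens< = subst (den (current s₀) *ₙ den (current s₁) <ₙ_) (ℕ.*-comm (den (current s₂)) (den (current s₁)))
      (ℕ.*-monoˡ-< (den (current s₁)) (ℕ.<-trans (Step.den-current<den-next s₀) (Step.den-current<den-next s₁)))

module CompleteRightSequence (α : IrrationalIn01) (r : ℕ → ℚ) (complete : CompleteRight α r) where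

  decreasing : ∀ i → r (suc i) < r i
  decreasing = proj₁ (proj₂ (proj₁ complete))

  best : ∀ i → RightBestApproximant α (r i)
  best = proj₂ (proj₂ (proj₁ complete))

  antitone : ∀ {i j} → i ≤ j → r j ℚ.≤ r i
  antitone = stepwise-mono ℚ._≥_ ℚ.≤-refl (λ p q → ℚ.≤-trans q p) r (λ i → ℚ.<⇒≤ (decreasing i))

  successor-≥ : ∀ {i q} → RightBestApproximant α q → q < r i → q ℚ.≤ r (suc i)
  successor-≥ {i} q-best q<ri with proj₂ complete _ q-best
  ... | j , refl with suc i ℕ.≤? j
  ...   | yes i<j = antitone i<j
  ...   | no i≮j = ⊥-elim (ℚ.<-irrefl refl (ℚ.<-≤-trans q<ri (antitone (ℕ.≤-pred (ℕ.≰⇒> i≮j)))))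

  record Stage (i : ℕ) : Set where
    field
      current neighbour : Fraction
      r≡current : r i ≡ ⟦ current ⟧
      neighbour-adjacent : Adjacent neighbour current
      neighbour-below : Lt α ⟦ neighbour ⟧

  module Step {i : ℕ} (s : Stage i) where
    open Stage s

    approach : ℕ → Fraction
    approach = fold neighbour (_⊕ current)

    adjacent-approach : ∀ t → Adjacent (approach t) current
    adjacent-approach zero = neighbour-adjacent
    adjacent-approach (suc t) = adjacent-⊕ʳ (adjacent-approach t)

    t<den-approach : ∀ t → t <ₙ den (approach t)
    t<den-approach zero = ℕ.0<1+n
    t<den-approach (suc t) = ℕ.≤-<-trans (t<den-approach t) (den<den-⊕ˡ (approach t) current)

    y : Fraction
    y = toFraction (r (suc i))

    ⟦y⟧≡ : ⟦ y ⟧ ≡ r (suc i)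
    ⟦y⟧≡ = ⟦toFraction⟧ (r (suc i)) (proj₁ (best (suc i)))

    y≺current : y ≺ current
    y≺current = <⇒≺ {y} {current} (subst₂ _<_ (sym ⟦y⟧≡) r≡current (decreasing i))

    approach-eventually-above : Gt α ⟦ approach (den y) ⟧
    approach-eventually-above with located α ⟦ approach (den y) ⟧
    ... | inj₂ above = above
    ... | inj₁ below = ⊥-elim (ℕ.<⇒≱ (t<den-approach (den y))
            (ℕ.≤-trans (ℕ.m≤m+n _ (den current))
              (adjacent-between-den (adjacent-approach (den y)) approach≺y y≺current)))
      where
      y-above : Gt α ⟦ y ⟧
      y-above = subst (Gt α) (sym ⟦y⟧≡) (rightBest⇒above α (best (suc i)))
      approach≺y : approach (den y) ≺ y
      approach≺y = <⇒≺ {approach (den y)} {y} (below<above α below y-above)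

    crossover : ∃[ t ] Lt α ⟦ approach t ⟧ × Gt α ⟦ approach (suc t) ⟧
    crossover = crossing (λ t → swap (located α ⟦ approach t ⟧))
                  (λ above → disjoint α _ neighbour-below above) (den y) approach-eventually-above

    t : ℕ
    t = proj₁ crossover

    next : Fraction
    next = approach (suc t)

    next-above : Gt α ⟦ next ⟧
    next-above = proj₂ (proj₂ crossover)

    adjacent-next : Adjacent next current
    adjacent-next = adjacent-approach (suc t)

    den-current<den-next : den current <ₙ den next
    den-current<den-next = den<den-⊕ʳ (approach t) current

    next-best : RightBestApproximant α ⟦ next ⟧
    next-best = adjacent⇒rightBest α (adjacent-⊕ˡ (adjacent-approach t)) (proj₁ (proj₂ crossover)) next-above

    den-next≤ : ⟦ next ⟧ < r (suc i) → den next ≤ ↧ₙ r (suc i)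
    den-next≤ next<ri+1 = ℕ.≤-trans (ℕ.m≤m+n (den next) (den current))
      (adjacent-between-den adjacent-next
        (<⇒≺ {next} {y} (subst (⟦ next ⟧ <_) (sym ⟦y⟧≡) next<ri+1)) y≺current)

    next≮r-suc : ¬ ⟦ next ⟧ < r (suc i)
    next≮r-suc next<ri+1 with rightBest-at α (best (suc i)) next (den-next≤ next<ri+1)
    ... | inj₁ (_ , ri+1≤next) = ℚ.<-irrefl refl (ℚ.<-≤-trans next<ri+1 ri+1≤next)
    ... | inj₂ next-below = disjoint α _ next-below next-above

    r-suc≡next : r (suc i) ≡ ⟦ next ⟧
    r-suc≡next = ℚ.≤-antisym (ℚ.≮⇒≥ next≮r-suc) (successor-≥ next-best next<current)
      where
      next<current : ⟦ next ⟧ < r i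
      next<current = subst (⟦ next ⟧ <_) (sym r≡current) (≺⇒< {next} {current} (adjacent⇒≺ adjacent-next))

    next-stage : Stage (suc i)
    next-stage = record
      { current = next
      ; neighbour = approach t
      ; r≡current = r-suc≡next
      ; neighbour-adjacent = adjacent-⊕ˡ (adjacent-approach t)
      ; neighbour-below = proj₁ (proj₂ crossover)
      }

  stage : ∀ i → Stage i
  stage zero = record
    { current = 1 /1+ 0
    ; neighbour = 0 /1+ 0
    ; r≡current = trans (proj₁ (proj₁ complete)) (sym (⟦⟧≡frac (1 /1+ 0)))
    ; neighbour-adjacent = adjacent refl
    ; neighbour-below = subst (Lt α) (sym (⟦⟧≡frac (0 /1+ 0))) (Lt-zero α)
    }
  stage (suc i) = Step.next-stage (stage i)

  gaps-decrease : ∀ i → r (suc i) - r (suc (suc i)) < r i - r (suc i)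
  gaps-decrease i =
    subst₂ _<_ (sym (cong₂ _-_ (r≡current s₁) (r≡current s₂)))
               (sym (cong₂ _-_ (r≡current s₀) (r≡current s₁)))
      (adjacent-gap-< (Step.adjacent-next s₀) (Step.adjacent-next s₁) dens<)
    where
    open Stage
    s₀ : Stage i
    s₀ = stage i
    s₁ : Stage (suc i)
    s₁ = stage (suc i)
    s₂ : Stage (suc (suc i))
    s₂ = stage (suc (suc i))
    dens< : den (current s₁) *ₙ den (current s₀) <ₙ den (current s₂) *ₙ den (current s₁)
    dens< = subst (_<ₙ den (current s₂) *ₙ den (current s₁)) (ℕ.*-comm (den (current s₀)) (den (current s₁)))
      (ℕ.*-monoˡ-< (den (current s₁)) (ℕ.<-trans (Step.den-current<den-next s₀) (Step.den-current<den-next s₁)))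

mainTheorem12 : (α : IrrationalIn01) →
    ((r : ℕ → ℚ) → CompleteLeft α r →
       ∀ i → (r (suc (suc i)) - r (suc i)) < (r (suc i) - r i))
    × ((r : ℕ → ℚ) → CompleteRight α r →
       ∀ i → (r (suc i) - r (suc (suc i))) < (r i - r (suc i)))
mainTheorem12 α = (λ r complete → CompleteLeftSequence.gaps-decrease α r complete)
                , (λ r complete → CompleteRightSequence.gaps-decrease α r complete)
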